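{- Let $K(v)$ be a complete multipartite graph and $E$ a set of edges of $K(v)$. If there is a garland of type $K(2,1,1)$ in $\langle E\rangle$, then the number of garlands does not exceed $13\cdot 2^{|E|-5} - 1$.
   Context: All graphs are finite and simple. For a sequence $v=(v_1,\dots,v_t)$ of positive integers, $K(v)$ is the complete $t$-partite graph with parts $V_1,\dots,V_t$, $|V_i|=v_i$. $\langle E\rangle$ is the subgraph of $K(v)$ consisting of the edges of $E$ and their endpoints. An $E$-subgraph is a subgraph $G_1$ of $K(v)$ which is a complete multipartite graph (with at least two nonempty parts) such that every part of $G_1$ is contained in some part of $K(v)$ and every edge of $G_1$ belongs to $E$. A garland is a nonempty set of pairwise vertex-disjoint $E$-subgraphs. A garland $\{G'_1,\dots,G'_p\}$ has type $H_1\dot\cup\cdots\dot\cup H_p$ if $G'_i\cong H_i$ for all $i$; thus a garland of type $K(2,1,1)$ is a single $E$-subgraph isomorphic to the complete tripartite graph $K(2,1,1)$. -}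

module Defs where

open import Data.Nat using (ℕ; zero; suc; _<ᵇ_)
open import Data.Bool using (Bool; true; false; _∧_; if_then_else_)
open import Data.Fin using (Fin; toℕ)
open import Data.List using (List; []; _∷_; map; allFin)
open import Data.Nat.ListAction using (sum)
open import Data.List.Relation.Unary.Any using (Any)
open import Data.List.Relation.Unary.All using (All)
open import Data.List.Relation.Unary.AllPairs using (AllPairs)
open import Data.Product using (Σ; ∃; ∃-syntax; _×_; _,_)
open import Data.Empty using (⊥)
open import Function.Definitions using (Injective)
open import Relation.Nullary using (¬_)
open import Relation.Binary.PropositionalEquality using (_≡_; _≢_)

-- Vertices are Fin n; c : Fin n → Fin t assigns each vertex its part,
-- so V_i = c⁻¹(i) and v_i = |V_i|.  Positivity of all v_i is the
-- surjectivity of c (imposed in the statement).  Two vertices are adjacent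
-- in K(v) iff they lie in different parts.

record IsEdgeSet {n t : ℕ} (c : Fin n → Fin t) (E : Fin n → Fin n → Bool) : Set where
  field
    sym     : ∀ x y → E x y ≡ E y x
    inKv    : ∀ x y → E x y ≡ true → c x ≢ c y

edgeCount : {n : ℕ} → (Fin n → Fin n → Bool) → ℕ
edgeCount {n} E =
  sum (map (λ x → sum (map (λ y → if (toℕ x <ᵇ toℕ y) ∧ E x y then 1 else 0)
                           (allFin n)))
           (allFin n))

record Graph (n : ℕ) : Set where
  constructor mkGraph
  field
    vert : Fin n → Bool
    adj  : Fin n → Fin n → Bool
open Graph public

_≈G_ : {n : ℕ} → Graph n → Graph n → Set
G ≈G H = (∀ x → vert G x ≡ vert H x) × (∀ x y → adj G x y ≡ adj H x y)

record IsESubgraph {n t : ℕ} (c : Fin n → Fin t) (E : Fin n → Fin n → Bool)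
                   (G : Graph n) : Set where
  field
    label       : Fin n → Fin n
    complete    : ∀ x y → adj G x y ≡ true →
                    vert G x ≡ true × vert G y ≡ true × label x ≢ label y
    complete'   : ∀ x y → vert G x ≡ true → vert G y ≡ true →
                    label x ≢ label y → adj G x y ≡ true
    twoParts    : ∃[ x ] ∃[ y ] (vert G x ≡ true × vert G y ≡ true × label x ≢ label y)
    partsInside : ∀ x y → vert G x ≡ true → vert G y ≡ true →
                    label x ≡ label y → c x ≡ c y
    subgraph    : ∀ x y → adj G x y ≡ true → c x ≢ c y
    edgesInE    : ∀ x y → adj G x y ≡ true → E x y ≡ true

k211part : Fin 4 → ℕ
k211part Fin.zero = 0
k211part (Fin.suc Fin.zero) = 0
k211part (Fin.suc (Fin.suc Fin.zero)) = 1
k211part (Fin.suc (Fin.suc (Fin.suc Fin.zero))) = 2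

k211adj : Fin 4 → Fin 4 → Bool
k211adj a b with k211part a Data.Nat.≟ k211part b
... | Relation.Nullary.yes _ = false
... | Relation.Nullary.no _  = true

-- G ≅ K(2,1,1): an injection φ : Fin 4 → Fin n onto the vertex set of G
-- which carries the adjacency of K(2,1,1) to that of G (G has no edges
-- outside its vertex set, as guaranteed for E-subgraphs).
IsoK211 : {n : ℕ} → Graph n → Set
IsoK211 {n} G =
  Σ (Fin 4 → Fin n) λ φ →
    Injective _≡_ _≡_ φ ×
    (∀ a → vert G (φ a) ≡ true) ×
    (∀ x → vert G x ≡ true → ∃[ a ] φ a ≡ x) ×
    (∀ a b → adj G (φ a) (φ b) ≡ k211adj a b)

-- Garlands: nonempty sets of pairwise vertex-disjoint E-subgraphs,
-- represented by a list of (pairwise disjoint, hence distinct) members.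

Disjoint : {n : ℕ} → Graph n → Graph n → Set
Disjoint G H = ∀ x → vert G x ≡ true → vert H x ≡ true → ⊥

record Garland {n t : ℕ} (c : Fin n → Fin t) (E : Fin n → Fin n → Bool) : Set where
  field
    members   : List (Graph n)
    nonempty  : members ≢ []
    areESub   : All (IsESubgraph c E) members
    disjoint  : AllPairs Disjoint members
open Garland public

SameGarland : {n t : ℕ} {c : Fin n → Fin t} {E : Fin n → Fin n → Bool} →
              Garland c E → Garland c E → Set
SameGarland g h =
  All (λ G → Any (G ≈G_) (members h)) (members g) ×
  All (λ H → Any (H ≈G_) (members g)) (members h)

module Submission where

-- Fix an E-subgraph G ≅ K(2,1,1) with embedding φ : Fin 4 → Fin n.  A garland
-- is a family of pairwise disjoint E-subgraphs; we use three facts about it.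
--  * It is determined by the set of edges it covers (same-covered⇒same-garland).
--  * On an edge between different parts of K(v), "covered" means "both ends lie
--    in a common member", a symmetric transitive relation.  On the five edges
--    of the copy φ such a relation leaves one of only thirteen patterns
--    (pattern∈table, a finite check by evaluation).
--  * On every other edge of E, of which there are at most |E| - 5, the garland
--    may do anything.
-- Hence the code "position of the pattern (a digit below 13) followed by the
-- free edges in binary" determines the garland and is below 13·2^(|E|-5).  The
-- empty family has code 0 and no garland has, leaving 13·2^(|E|-5) - 1 codes.

open import Defs
open import Data.Nat hiding (_≟_)
open import Data.Nat.Properties hiding (_≟_)
open import Data.Nat.DivMod using (_%_; [m+kn]%n≡m%n; m<n⇒m%n≡m)
open import Data.Nat.ListAction using (sum)
open import Data.Nat.ListAction.Properties using (sum-++)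
open import Data.Bool using (Bool; true; false; _∧_; _∨_; not; if_then_else_; T)
open import Data.Bool.Properties using (T-≡; T-∧; T?; ∧-comm)
import Data.Bool.Properties as Bool
open import Data.Bool.ListAction using (any)
open import Data.Fin using (Fin; toℕ; #_; _≟_)
open import Data.Fin.Properties using (toℕ<n; toℕ-injective)
open import Data.List using (List; []; _∷_; _++_; map; filterᵇ; length; lookup; upTo; allFin; cartesianProduct)
open import Data.List.Properties using (length-++; length-upTo; length-map; map-++; map-∘; ∷-injectiveˡ; ∷-injectiveʳ)
import Data.List.Properties as List
open import Data.List.Relation.Unary.All as All using (All; []; _∷_)
import Data.List.Relation.Unary.All.Properties as All
open import Data.List.Relation.Unary.AllPairs as AllPairs using (AllPairs; []; _∷_; allPairs?)
import Data.List.Relation.Unary.AllPairs.Properties as AllPairs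
open import Data.List.Relation.Unary.Any as Any using (Any; here; there; index)
open import Data.List.Relation.Unary.Any.Properties using (any⁺; any⁻; lookup-index)
open import Data.List.Membership.Propositional using (_∈_; find; lose)
open import Data.List.Membership.Propositional.Properties
  using (∈-∃++; ∈-++⁻; ∈-++⁺ˡ; ∈-++⁺ʳ; ∈-upTo⁺; ∈-map⁻; ∈-filter⁺; ∈-cartesianProduct⁺; ∈-allFin)
open import Data.List.Membership.DecPropositional (List.≡-dec Bool._≟_) using (_∈?_)
open import Data.Product using (∃-syntax; _×_; _,_; proj₁; proj₂; uncurry; swap)
open import Data.Product.Properties using (,-injectiveˡ; ,-injectiveʳ)
import Data.Product.Properties as Product
open import Data.Sum using (_⊎_; inj₁; inj₂)
open import Data.Empty using (⊥-elim)
open import Function using (_∘_)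
open import Function.Bundles using (Equivalence)
open import Function.Definitions using (Injective; Surjective)
open import Relation.Nullary using (¬_; yes; no)
open import Relation.Nullary.Decidable using (toWitness; fromWitness; fromWitnessFalse; ⌊_⌋; ¬?; _×-dec_; _⊎-dec_)
open import Relation.Binary.Definitions using (tri<; tri≈; tri>)
open import Relation.Binary.PropositionalEquality

bool-ext : ∀ {a b} → (a ≡ true → b ≡ true) → (b ≡ true → a ≡ true) → a ≡ b
bool-ext {false} {false} _ _ = refl
bool-ext {false} {true}  _ g = g refl
bool-ext {true}  {false} f _ = sym (f refl)
bool-ext {true}  {true}  _ _ = refl

true≢false : true ≢ false
true≢false ()

∧-split : ∀ {a b} → a ∧ b ≡ true → a ≡ true × b ≡ true
∧-split {true} {true} _ = refl , refl

∧-intro : ∀ {a b} → a ≡ true → b ≡ true → a ∧ b ≡ true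
∧-intro refl refl = refl

∧-introᵀ : ∀ {a b} → T a → T b → T (a ∧ b)
∧-introᵀ p q = Equivalence.from T-∧ (p , q)

_⇒ᵇ_ : Bool → Bool → Bool
a ⇒ᵇ b = not a ∨ b

⇒ᵇ-intro : ∀ {a b c} → (a ≡ true → b ≡ true → c ≡ true) → T ((a ∧ b) ⇒ᵇ c)
⇒ᵇ-intro {false}               _ = _
⇒ᵇ-intro {true} {false}        _ = _
⇒ᵇ-intro {true} {true} {true}  _ = _
⇒ᵇ-intro {true} {true} {false} h = true≢false (sym (h refl refl))

⇒ᵇ-elim : ∀ {a b} → T (a ⇒ᵇ b) → T a → T b
⇒ᵇ-elim {true} h _ = h

BoolFun : ℕ → Set
BoolFun zero    = Bool
BoolFun (suc k) = Bool → BoolFun k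

everywhere : ∀ k → BoolFun k → Bool
everywhere zero    b = b
everywhere (suc k) f = everywhere k (f false) ∧ everywhere k (f true)

Holds : ∀ k → BoolFun k → Set
Holds zero    b = T b
Holds (suc k) f = ∀ b → Holds k (f b)

everywhere-sound : ∀ k (f : BoolFun k) → T (everywhere k f) → Holds k f
everywhere-sound zero    b h = h
everywhere-sound (suc k) f h false =
  everywhere-sound k (f false) (proj₁ (Equivalence.to (T-∧ {everywhere k (f false)}) h))
everywhere-sound (suc k) f h true  =
  everywhere-sound k (f true) (proj₂ (Equivalence.to (T-∧ {everywhere k (f false)}) h))

module _ {A : Set} where

  any-witness : (p : A → Bool) (xs : List A) → any p xs ≡ true → ∃[ x ] (x ∈ xs × p x ≡ true)
  any-witness p xs e with find (any⁻ p xs (Equivalence.from T-≡ e))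
  ... | x , x∈xs , px = x , x∈xs , Equivalence.to T-≡ px

  any-intro : (p : A → Bool) {xs : List A} {x : A} → x ∈ xs → p x ≡ true → any p xs ≡ true
  any-intro p x∈xs px = Equivalence.to T-≡ (any⁺ p (lose x∈xs (Equivalence.from T-≡ px)))

  map-pointwise : {B : Set} (f g : A → B) {xs : List A} → map f xs ≡ map g xs →
                  ∀ {x} → x ∈ xs → f x ≡ g x
  map-pointwise f g {_ ∷ _} eq (here refl) = ∷-injectiveˡ eq
  map-pointwise f g {_ ∷ _} eq (there x∈) = map-pointwise f g (∷-injectiveʳ eq) x∈

  unique-⊆-length : {xs ys : List A} → AllPairs _≢_ xs → (∀ {z} → z ∈ xs → z ∈ ys) →
                    length xs ≤ length ys
  unique-⊆-length [] _ = z≤n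
  unique-⊆-length {x ∷ xs} (x∉xs ∷ xs!) xs⊆ys with ∈-∃++ (xs⊆ys (here refl))
  ... | us , vs , refl = begin
      suc (length xs)             ≤⟨ s≤s (unique-⊆-length xs! xs⊆us++vs) ⟩
      suc (length (us ++ vs))     ≡⟨ cong suc (length-++ us) ⟩
      suc (length us + length vs) ≡⟨ +-suc (length us) (length vs) ⟨
      length us + length (x ∷ vs) ≡⟨ length-++ us ⟨
      length (us ++ x ∷ vs)       ∎
    where
    open ≤-Reasoning
    xs⊆us++vs : ∀ {z} → z ∈ xs → z ∈ us ++ vs
    xs⊆us++vs z∈xs with ∈-++⁻ us (xs⊆ys (there z∈xs))
    ... | inj₁ z∈us         = ∈-++⁺ˡ z∈us
    ... | inj₂ (here refl)  = ⊥-elim (All.lookup x∉xs z∈xs refl)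
    ... | inj₂ (there z∈vs) = ∈-++⁺ʳ us z∈vs

  length-filter-split : (p q : A → Bool) (xs : List A) →
    length (filterᵇ p xs) ≡
      length (filterᵇ (λ z → p z ∧ not (q z)) xs) + length (filterᵇ (λ z → p z ∧ q z) xs)
  length-filter-split p q [] = refl
  length-filter-split p q (x ∷ xs) with p x | q x
  ... | false | _     = length-filter-split p q xs
  ... | true  | false = cong suc (length-filter-split p q xs)
  ... | true  | true  = trans (cong suc (length-filter-split p q xs)) (sym (+-suc _ _))

  sum-indicator : (p : A → Bool) (xs : List A) →
    sum (map (λ z → if p z then 1 else 0) xs) ≡ length (filterᵇ p xs)
  sum-indicator p [] = refl
  sum-indicator p (x ∷ xs) with p x
  ... | true  = cong suc (sum-indicator p xs)
  ... | false = sum-indicator p xs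

sum-cartesianProduct : {A B : Set} (h : A × B → ℕ) (xs : List A) (ys : List B) →
  sum (map h (cartesianProduct xs ys)) ≡ sum (map (λ x → sum (map (λ y → h (x , y)) ys)) xs)
sum-cartesianProduct h [] ys = refl
sum-cartesianProduct h (x ∷ xs) ys = begin
  sum (map h (map (x ,_) ys ++ cartesianProduct xs ys))
    ≡⟨ cong sum (map-++ h (map (x ,_) ys) _) ⟩
  sum (map h (map (x ,_) ys) ++ map h (cartesianProduct xs ys))
    ≡⟨ sum-++ (map h (map (x ,_) ys)) _ ⟩
  sum (map h (map (x ,_) ys)) + sum (map h (cartesianProduct xs ys))
    ≡⟨ cong₂ _+_ (cong sum (sym (map-∘ ys))) (sum-cartesianProduct h xs ys) ⟩
  sum (map (λ y → h (x , y)) ys) + sum (map (λ x → sum (map (λ y → h (x , y)) ys)) xs) ∎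
  where open ≡-Reasoning

unique-bounded-length : ∀ {N} {ns : List ℕ} → AllPairs _≢_ ns → All (_< N) ns → length ns ≤ N
unique-bounded-length {N} ns! ns<N = begin
    _               ≤⟨ unique-⊆-length ns! (λ k∈ns → ∈-upTo⁺ (All.lookup ns<N k∈ns)) ⟩
    length (upTo N) ≡⟨ length-upTo N ⟩
    N               ∎
  where open ≤-Reasoning

-- Pairwise inequivalent objects, coded injectively by nonzero numbers below N,
-- number at most N - 1: together with 0 their codes are distinct numbers below N.
count-by-codes : {A : Set} {_≈_ : A → A → Set} (code : A → ℕ) {N : ℕ} → 0 < N →
  (∀ a → code a ≢ 0) → (∀ a → code a < N) → (∀ {a b} → code a ≡ code b → a ≈ b) →
  (xs : List A) → AllPairs (λ a b → ¬ a ≈ b) xs → length xs ≤ N ∸ 1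
count-by-codes code {N} 0<N nonzero bounded injective xs xs-distinct =
  subst (length xs ≤_) (pred[m∸n]≡m∸[1+n] N 0) (suc[m]≤n⇒m≤pred[n] (begin
    suc (length xs)          ≡⟨ cong suc (length-map code xs) ⟨
    length (0 ∷ map code xs) ≤⟨ unique-bounded-length (zero-fresh ∷ codes-distinct) (0<N ∷ codes<N) ⟩
    N                        ∎))
  where
  open ≤-Reasoning
  zero-fresh : All (0 ≢_) (map code xs)
  zero-fresh = All.map⁺ (All.tabulate λ {a} _ e → nonzero a (sym e))
  codes-distinct : AllPairs _≢_ (map code xs)
  codes-distinct = AllPairs.map⁺ (AllPairs.map (λ a≉b eq → a≉b (injective eq)) xs-distinct)
  codes<N : All (_< N) (map code xs)
  codes<N = All.map⁺ (All.tabulate λ {a} _ → bounded a)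

index-injective : {A : Set} {xs : List A} {x y : A} (p : x ∈ xs) (q : y ∈ xs) →
                  toℕ (index p) ≡ toℕ (index q) → x ≡ y
index-injective {xs = xs} p q eq = begin
  _                   ≡⟨ lookup-index p ⟩
  lookup xs (index p) ≡⟨ cong (lookup xs) (toℕ-injective eq) ⟩
  lookup xs (index q) ≡⟨ lookup-index q ⟨
  _                   ∎
  where open ≡-Reasoning

digits-unique : ∀ k .{{_ : NonZero k}} {d e x y : ℕ} → d < k → e < k →
                d + x * k ≡ e + y * k → d ≡ e × x ≡ y
digits-unique k {d} {e} {x} {y} d<k e<k eq = d≡e , *-cancelʳ-≡ x y k (+-cancelˡ-≡ d _ _ eq′)
  where
  open ≡-Reasoning
  d≡e : d ≡ e
  d≡e = begin
    d                ≡⟨ m<n⇒m%n≡m d<k ⟨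
    d % k            ≡⟨ [m+kn]%n≡m%n d x k ⟨
    (d + x * k) % k  ≡⟨ cong (_% k) eq ⟩
    (e + y * k) % k  ≡⟨ [m+kn]%n≡m%n e y k ⟩
    e % k            ≡⟨ m<n⇒m%n≡m e<k ⟩
    e                ∎
  eq′ : d + x * k ≡ d + y * k
  eq′ = trans eq (cong (_+ y * k) (sym d≡e))

digits-bound : ∀ {k m d x : ℕ} → d < k → x < m → d + x * k < m * k
digits-bound {k} {m} {d} {x} d<k x<m = begin-strict
    d + x * k <⟨ +-monoˡ-< (x * k) d<k ⟩
    suc x * k ≤⟨ *-monoˡ-≤ k x<m ⟩
    m * k     ∎
  where open ≤-Reasoning

bit : Bool → ℕ
bit false = 0
bit true  = 1

bit<2 : ∀ b → bit b < 2
bit<2 false = s≤s z≤n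
bit<2 true  = s≤s (s≤s z≤n)

bit-injective : ∀ {a b} → bit a ≡ bit b → a ≡ b
bit-injective {false} {false} _ = refl
bit-injective {true}  {true}  _ = refl

module _ {A : Set} where

  binary : (A → Bool) → List A → ℕ
  binary f []       = 0
  binary f (z ∷ zs) = bit (f z) + binary f zs * 2

  binary< : ∀ f zs → binary f zs < 2 ^ length zs
  binary< f []       = s≤s z≤n
  binary< f (z ∷ zs) = subst (binary f (z ∷ zs) <_) (*-comm (2 ^ length zs) 2)
                             (digits-bound (bit<2 (f z)) (binary< f zs))

  binary-injective : ∀ f g zs → binary f zs ≡ binary g zs → ∀ {z} → z ∈ zs → f z ≡ g z
  binary-injective f g (z ∷ zs) eq z∈
    with digits-unique 2 {x = binary f zs} {binary g zs} (bit<2 (f z)) (bit<2 (g z)) eq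
  binary-injective f g (z ∷ zs) eq (here refl) | fz≡gz , _ = bit-injective fz≡gz
  binary-injective f g (z ∷ zs) eq (there z∈)  | _ , rest  = binary-injective f g zs rest z∈

  binary-zero : ∀ zs → binary (λ _ → false) zs ≡ 0
  binary-zero []       = refl
  binary-zero (z ∷ zs) = cong (_* 2) (binary-zero zs)

k211edges : List (Fin 4 × Fin 4)
k211edges = (# 0 , # 2) ∷ (# 0 , # 3) ∷ (# 1 , # 2) ∷ (# 1 , # 3) ∷ (# 2 , # 3) ∷ []

k211edges-adjacent : All (λ e → k211adj (proj₁ e) (proj₂ e) ≡ true) k211edges
k211edges-adjacent = refl ∷ refl ∷ refl ∷ refl ∷ refl ∷ []

SameEnds : {A : Set} → A × A → A × A → Set
SameEnds (i , j) (k , l) = (i ≡ k × j ≡ l) ⊎ (i ≡ l × j ≡ k)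

k211edges-distinct : AllPairs (λ e e′ → ¬ SameEnds e e′) k211edges
k211edges-distinct = toWitness {a? = allPairs? (λ { (i , j) (k , l) →
  ¬? (((i ≟ k) ×-dec (j ≟ l)) ⊎-dec ((i ≟ l) ×-dec (j ≟ k))) }) k211edges} _

edgePattern : (Fin 4 → Fin 4 → Bool) → List Bool
edgePattern R = map (uncurry R) k211edges

-- The thirteen patterns left by symmetric transitive relations, the empty one first.
k211patterns : List (List Bool)
k211patterns =
  (false ∷ false ∷ false ∷ false ∷ false ∷ []) ∷
  (false ∷ false ∷ false ∷ false ∷ true  ∷ []) ∷
  (false ∷ false ∷ false ∷ true  ∷ false ∷ []) ∷
  (false ∷ false ∷ true  ∷ false ∷ false ∷ []) ∷
  (false ∷ true  ∷ false ∷ false ∷ false ∷ []) ∷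
  (true  ∷ false ∷ false ∷ false ∷ false ∷ []) ∷
  (false ∷ true  ∷ false ∷ true  ∷ false ∷ []) ∷
  (false ∷ true  ∷ true  ∷ false ∷ false ∷ []) ∷
  (true  ∷ false ∷ false ∷ true  ∷ false ∷ []) ∷
  (true  ∷ false ∷ true  ∷ false ∷ false ∷ []) ∷
  (false ∷ false ∷ true  ∷ true  ∷ true  ∷ []) ∷
  (true  ∷ true  ∷ false ∷ false ∷ true  ∷ []) ∷
  (true  ∷ true  ∷ true  ∷ true  ∷ true  ∷ []) ∷ []

triangle : (ab ac bc : Bool) → Bool
triangle ab ac bc = ((ab ∧ bc) ⇒ᵇ ac) ∧ ((ac ∧ bc) ⇒ᵇ ab) ∧ ((ab ∧ ac) ⇒ᵇ bc)

transitive4 : (r01 r02 r03 r12 r13 r23 : Bool) → Bool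
transitive4 r01 r02 r03 r12 r13 r23 =
  triangle r01 r02 r12 ∧ triangle r01 r03 r13 ∧ triangle r02 r03 r23 ∧ triangle r12 r13 r23

table-complete : Holds 6 λ r01 r02 r03 r12 r13 r23 →
  transitive4 r01 r02 r03 r12 r13 r23 ⇒ᵇ ⌊ (r02 ∷ r03 ∷ r12 ∷ r13 ∷ r23 ∷ []) ∈? k211patterns ⌋
table-complete = everywhere-sound 6 _ _

module _ (R : Fin 4 → Fin 4 → Bool) (R-sym : ∀ a b → R a b ≡ R b a)
         (R-trans : ∀ a b c → R a b ≡ true → R b c ≡ true → R a c ≡ true) where

  triangle-holds : ∀ a b c → T (triangle (R a b) (R a c) (R b c))
  triangle-holds a b c =
    ∧-introᵀ (⇒ᵇ-intro (R-trans a b c))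
   (∧-introᵀ (⇒ᵇ-intro λ ac bc → R-trans a c b ac (flip b c bc))
             (⇒ᵇ-intro λ ab ac → R-trans b a c (flip a b ab) ac))
    where
    flip : ∀ x y → R x y ≡ true → R y x ≡ true
    flip x y e = trans (R-sym y x) e

  pattern∈table : edgePattern R ∈ k211patterns
  pattern∈table = toWitness (⇒ᵇ-elim
    (table-complete (R (# 0) (# 1)) (R (# 0) (# 2)) (R (# 0) (# 3))
                    (R (# 1) (# 2)) (R (# 1) (# 3)) (R (# 2) (# 3)))
    (∧-introᵀ (triangle-holds (# 0) (# 1) (# 2)) (∧-introᵀ (triangle-holds (# 0) (# 1) (# 3))
    (∧-introᵀ (triangle-holds (# 0) (# 2) (# 3)) (triangle-holds (# 1) (# 2) (# 3))))))

module _ {n : ℕ} where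

  covered : List (Graph n) → Fin n → Fin n → Bool
  covered ms x y = any (λ G → adj G x y) ms

  together : List (Graph n) → Fin n → Fin n → Bool
  together ms x y = any (λ G → vert G x ∧ vert G y) ms

  member-unique : ∀ {ms : List (Graph n)} {G H z} → AllPairs Disjoint ms → G ∈ ms → H ∈ ms →
                  vert G z ≡ true → vert H z ≡ true → G ≡ H
  member-unique (_ ∷ _)   (here refl) (here refl) _ _ = refl
  member-unique (G# ∷ _)  (here refl) (there H∈)  g h = ⊥-elim (All.lookup G# H∈ _ g h)
  member-unique (H# ∷ _)  (there G∈)  (here refl) g h = ⊥-elim (All.lookup H# G∈ _ h g)
  member-unique (_ ∷ ms#) (there G∈)  (there H∈)  g h = member-unique ms# G∈ H∈ g h

  together-sym : ∀ ms x y → together ms x y ≡ together ms y x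
  together-sym []       x y = refl
  together-sym (G ∷ ms) x y = cong₂ _∨_ (∧-comm (vert G x) (vert G y)) (together-sym ms x y)

  together-trans : ∀ {ms} → AllPairs Disjoint ms → ∀ x y z →
                   together ms x y ≡ true → together ms y z ≡ true → together ms x z ≡ true
  together-trans {ms} ms# x y z xy yz
    with any-witness _ ms xy | any-witness _ ms yz
  ... | G , G∈ , Gxy | H , H∈ , Hyz with ∧-split Gxy | ∧-split Hyz
  ... | Gx , Gy | Hy , Hz =
    any-intro _ G∈ (∧-intro Gx (subst (λ K → vert K z ≡ true) (sym (member-unique ms# G∈ H∈ Gy Hy)) Hz))

module _ {n t : ℕ} (c : Fin n → Fin t) (E : Fin n → Fin n → Bool) where

  module _ {ms : List (Graph n)} (ms-sub : All (IsESubgraph c E) ms) where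

    covered-witness : ∀ x y → covered ms x y ≡ true →
      ∃[ G ] (G ∈ ms × adj G x y ≡ true × IsESubgraph c E G)
    covered-witness x y e with any-witness _ ms e
    ... | G , G∈ , Gxy = G , G∈ , Gxy , All.lookup ms-sub G∈

    covered-sym : ∀ x y → covered ms x y ≡ covered ms y x
    covered-sym x y = bool-ext (flip x y) (flip y x)
      where
      flip : ∀ x y → covered ms x y ≡ true → covered ms y x ≡ true
      flip x y e with covered-witness x y e
      ... | G , G∈ , Gxy , G-sub with IsESubgraph.complete G-sub x y Gxy
      ...   | Gx , Gy , ℓ = any-intro _ G∈ (IsESubgraph.complete' G-sub y x Gy Gx (ℓ ∘ sym))

    covered-irrefl : ∀ x → covered ms x x ≡ false
    covered-irrefl x with covered ms x x in e
    ... | false = refl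
    ... | true with covered-witness x x e
    ...   | _ , _ , Gxx , G-sub = ⊥-elim (proj₂ (proj₂ (IsESubgraph.complete G-sub x x Gxx)) refl)

    covered⊆E : ∀ x y → covered ms x y ≡ true → E x y ≡ true
    covered⊆E x y e with covered-witness x y e
    ... | _ , _ , Gxy , G-sub = IsESubgraph.edgesInE G-sub x y Gxy

    covered-outside-E : ∀ x y → E x y ≡ false → covered ms x y ≡ false
    covered-outside-E x y exy with covered ms x y in e
    ... | false = refl
    ... | true  = ⊥-elim (true≢false (trans (sym (covered⊆E x y e)) exy))

    -- Between different parts of K(v), covering and lying in a common member
    -- coincide, since each member is complete multipartite with parts inside
    -- those of K(v).
    covered≡together : ∀ x y → c x ≢ c y → covered ms x y ≡ together ms x y
    covered≡together x y cx≢cy = bool-ext to from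
      where
      to : covered ms x y ≡ true → together ms x y ≡ true
      to e with covered-witness x y e
      ... | G , G∈ , Gxy , G-sub with IsESubgraph.complete G-sub x y Gxy
      ...   | Gx , Gy , _ = any-intro _ G∈ (∧-intro Gx Gy)
      from : together ms x y ≡ true → covered ms x y ≡ true
      from e with any-witness _ ms e
      ... | G , G∈ , GxGy with ∧-split GxGy | All.lookup ms-sub G∈
      ...   | Gx , Gy | G-sub = any-intro _ G∈ (IsESubgraph.complete' G-sub x y Gx Gy
                                  (λ ℓ → cx≢cy (IsESubgraph.partsInside G-sub x y Gx Gy ℓ)))

  module _ {ms₁ ms₂ : List (Graph n)}
           (sub₁ : All (IsESubgraph c E) ms₁) (sub₂ : All (IsESubgraph c E) ms₂)
           (ms₂# : AllPairs Disjoint ms₂)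
           (cov⊆ : ∀ x y → covered ms₁ x y ≡ true → covered ms₂ x y ≡ true)
           {G H : Graph n} (G∈ : G ∈ ms₁) (H∈ : H ∈ ms₂) {x₀ y₀ : Fin n}
           (Gx₀y₀ : adj G x₀ y₀ ≡ true) (Hx₀y₀ : adj H x₀ y₀ ≡ true) where

    private
      module G = IsESubgraph (All.lookup sub₁ G∈)
      module H = IsESubgraph (All.lookup sub₂ H∈)

    -- An edge of G ending in H is an edge of H: the member of ms₂ covering it
    -- meets H, so by disjointness it is H.
    edge-into-H : ∀ z u → vert H u ≡ true → adj G z u ≡ true → adj H z u ≡ true
    edge-into-H z u Hu Gzu with covered-witness sub₂ z u (cov⊆ z u (any-intro _ G∈ Gzu))
    ... | H′ , H′∈ , H′zu , H′-sub with IsESubgraph.complete H′-sub z u H′zu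
    ...   | _ , H′u , _ = subst (λ K → adj K z u ≡ true) (member-unique ms₂# H′∈ H∈ H′u Hu) H′zu

    -- Each vertex of G is joined in G to x₀ or to y₀, which lie in distinct parts of G.
    vert⊆ : ∀ z → vert G z ≡ true → vert H z ≡ true
    vert⊆ z Gz with G.complete x₀ y₀ Gx₀y₀ | H.complete x₀ y₀ Hx₀y₀
    ... | Gx₀ , Gy₀ , ℓ₀ | Hx₀ , Hy₀ , _ with G.label z ≟ G.label x₀
    ...   | no  ℓ≢ = proj₁ (H.complete z x₀ (edge-into-H z x₀ Hx₀ (G.complete' z x₀ Gz Gx₀ ℓ≢)))
    ...   | yes ℓ≡ = proj₁ (H.complete z y₀ (edge-into-H z y₀ Hy₀
                       (G.complete' z y₀ Gz Gy₀ (λ e → ℓ₀ (trans (sym ℓ≡) e)))))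

    adj⊆ : ∀ z w → adj G z w ≡ true → adj H z w ≡ true
    adj⊆ z w Gzw = edge-into-H z w (vert⊆ w (proj₁ (proj₂ (G.complete z w Gzw)))) Gzw

  -- A garland is determined by the set of edges it covers: each member G of g
  -- shares an edge with a member H of h, and then G ⊆ H ⊆ G.
  same-covered⇒same-garland : (g h : Garland c E) →
    (∀ x y → covered (members g) x y ≡ covered (members h) x y) → SameGarland g h
  same-covered⇒same-garland g h eq = each-found g h eq , each-found h g (λ x y → sym (eq x y))
    where
    each-found : (g h : Garland c E) → (∀ x y → covered (members g) x y ≡ covered (members h) x y) →
                 All (λ G → Any (G ≈G_) (members h)) (members g)
    each-found g h eq = All.tabulate λ {G} G∈ →
      let open IsESubgraph (All.lookup (areESub g) G∈)
          (x₀ , y₀ , Gx₀ , Gy₀ , ℓ) = twoParts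
          Gx₀y₀ = complete' x₀ y₀ Gx₀ Gy₀ ℓ
          (H , H∈ , Hx₀y₀ , _) = covered-witness (areESub h) x₀ y₀
                                   (trans (sym (eq x₀ y₀)) (any-intro _ G∈ Gx₀y₀))
          g⊆h = λ x y e → trans (sym (eq x y)) e
          h⊆g = λ x y e → trans (eq x y) e
          G⊆H = vert⊆ (areESub g) (areESub h) (disjoint h) g⊆h G∈ H∈ Gx₀y₀ Hx₀y₀
          H⊆G = vert⊆ (areESub h) (areESub g) (disjoint g) h⊆g H∈ G∈ Hx₀y₀ Gx₀y₀
          G⊆Hₑ = adj⊆ (areESub g) (areESub h) (disjoint h) g⊆h G∈ H∈ Gx₀y₀ Hx₀y₀
          H⊆Gₑ = adj⊆ (areESub h) (areESub g) (disjoint g) h⊆g H∈ G∈ Hx₀y₀ Gx₀y₀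
      in Any.map (λ { refl → (λ z → bool-ext (G⊆H z) (H⊆G z))
                           , (λ z w → bool-ext (G⊆Hₑ z w) (H⊆Gₑ z w)) }) H∈

  -- A garland covers at least one edge: its first member has two parts.
  garland-covers-edge : (g : Garland c E) → ∃[ x ] ∃[ y ] (covered (members g) x y ≡ true)
  garland-covers-edge g with members g | nonempty g | areESub g
  ... | []     | nonempty | _         = ⊥-elim (nonempty refl)
  ... | G ∷ Gs | _        | G-sub ∷ _ with IsESubgraph.twoParts G-sub
  ...   | x , y , Gx , Gy , ℓ =
    x , y , any-intro (λ H → adj H x y) {G ∷ Gs} (here refl) (IsESubgraph.complete' G-sub x y Gx Gy ℓ)

orient : {n : ℕ} → Fin n → Fin n → Fin n × Fin n
orient x y = if toℕ x <ᵇ toℕ y then (x , y) else (y , x)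

orient-cases : {n : ℕ} (x y : Fin n) → orient x y ≡ (x , y) ⊎ orient x y ≡ (y , x)
orient-cases x y with toℕ x <ᵇ toℕ y
... | true  = inj₁ refl
... | false = inj₂ refl

orient-increasing : {n : ℕ} {x y : Fin n} → x ≢ y →
                    T (toℕ (proj₁ (orient x y)) <ᵇ toℕ (proj₂ (orient x y)))
orient-increasing {x = x} {y} x≢y with toℕ x <ᵇ toℕ y in lt
... | true  = subst T (sym lt) _
... | false = <⇒<ᵇ (≤∧≢⇒< (≮⇒≥ (λ x<y → subst T lt (<⇒<ᵇ x<y)))
                          (λ e → x≢y (toℕ-injective (sym e))))

module Coding {n t : ℕ} (c : Fin n → Fin t) (E : Fin n → Fin n → Bool)
              (E-sym : ∀ x y → E x y ≡ E y x)
              (φ : Fin 4 → Fin n) (φ-injective : Injective _≡_ _≡_ φ)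
              (φ-cross : ∀ {i j} → (i , j) ∈ k211edges → c (φ i) ≢ c (φ j))
              (φ-inE : ∀ {i j} → (i , j) ∈ k211edges → E (φ i) (φ j) ≡ true) where

  open import Data.List.Membership.DecPropositional (Product.≡-dec (_≟_ {n}) (_≟_ {n}))
    using () renaming (_∈?_ to _∈₂?_)

  pairs : List (Fin n × Fin n)
  pairs = cartesianProduct (allFin n) (allFin n)

  ∈-pairs : ∀ x y → (x , y) ∈ pairs
  ∈-pairs x y = ∈-cartesianProduct⁺ (∈-allFin x) (∈-allFin y)

  isEdge : Fin n × Fin n → Bool
  isEdge z = (toℕ (proj₁ z) <ᵇ toℕ (proj₂ z)) ∧ E (proj₁ z) (proj₂ z)

  copyEdge : Fin 4 × Fin 4 → Fin n × Fin n
  copyEdge e = orient (φ (proj₁ e)) (φ (proj₂ e))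

  copyEdges : List (Fin n × Fin n)
  copyEdges = map copyEdge k211edges

  inCopy : Fin n × Fin n → Bool
  inCopy z = ⌊ z ∈₂? copyEdges ⌋

  freeEdges : List (Fin n × Fin n)
  freeEdges = filterᵇ (λ z → isEdge z ∧ not (inCopy z)) pairs

  copyEdges⁻ : ∀ {z} → z ∈ copyEdges → ∃[ i ] ∃[ j ] ((i , j) ∈ k211edges × z ≡ orient (φ i) (φ j))
  copyEdges⁻ z∈ with ∈-map⁻ copyEdge z∈
  ... | (i , j) , ij∈ , refl = i , j , ij∈ , refl

  φ²-injective : ∀ {i j k l} → (φ i , φ j) ≡ (φ k , φ l) → i ≡ k × j ≡ l
  φ²-injective eq = φ-injective (,-injectiveˡ eq) , φ-injective (,-injectiveʳ eq)

  copyEdges-distinct : AllPairs _≢_ copyEdges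
  copyEdges-distinct =
    AllPairs.map⁺ (AllPairs.map (λ {e} {e′} distinct eq → distinct (same-ends e e′ eq)) k211edges-distinct)
    where
    same-ends : ∀ e e′ → copyEdge e ≡ copyEdge e′ → SameEnds e e′
    same-ends (i , j) (k , l) eq
      with orient-cases (φ i) (φ j) | orient-cases (φ k) (φ l)
    ... | inj₁ o | inj₁ o′ = inj₁ (φ²-injective (trans (sym o) (trans eq o′)))
    ... | inj₁ o | inj₂ o′ = inj₂ (φ²-injective (trans (sym o) (trans eq o′)))
    ... | inj₂ o | inj₁ o′ = inj₂ (swap (φ²-injective (trans (sym o) (trans eq o′))))
    ... | inj₂ o | inj₂ o′ = inj₁ (swap (φ²-injective (trans (sym o) (trans eq o′))))

  copyEdges-inE : ∀ {z} → z ∈ copyEdges → T (isEdge z)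
  copyEdges-inE z∈ with copyEdges⁻ z∈
  ... | i , j , ij∈ , refl =
    ∧-introᵀ (orient-increasing (λ e → φ-cross ij∈ (cong c e))) (Equivalence.from T-≡ inE)
    where
    inE : E (proj₁ (orient (φ i) (φ j))) (proj₂ (orient (φ i) (φ j))) ≡ true
    inE with orient-cases (φ i) (φ j)
    ... | inj₁ o rewrite o = φ-inE ij∈
    ... | inj₂ o rewrite o = trans (E-sym (φ j) (φ i)) (φ-inE ij∈)

  copyCount : ℕ
  copyCount = length (filterᵇ (λ z → isEdge z ∧ inCopy z) pairs)

  edgeCount-split : edgeCount E ≡ length freeEdges + copyCount
  edgeCount-split = begin
    edgeCount E
      ≡⟨ sum-cartesianProduct (λ z → if isEdge z then 1 else 0) (allFin n) (allFin n) ⟨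
    sum (map (λ z → if isEdge z then 1 else 0) pairs)
      ≡⟨ sum-indicator isEdge pairs ⟩
    length (filterᵇ isEdge pairs)
      ≡⟨ length-filter-split isEdge inCopy pairs ⟩
    length freeEdges + copyCount ∎
    where open ≡-Reasoning

  five≤copyCount : 5 ≤ copyCount
  five≤copyCount = unique-⊆-length copyEdges-distinct λ {z} z∈ →
    ∈-filter⁺ (λ z → T? (isEdge z ∧ inCopy z)) (∈-pairs (proj₁ z) (proj₂ z))
              (∧-introᵀ (copyEdges-inE z∈) (fromWitness z∈))

  freeEdges-bound : length freeEdges ≤ edgeCount E ∸ 5
  freeEdges-bound = m+n≤o⇒m≤o∸n (length freeEdges)
    (≤-trans (+-monoʳ-≤ (length freeEdges) five≤copyCount) (≤-reflexive (sym edgeCount-split)))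

  copyRelation : List (Graph n) → Fin 4 → Fin 4 → Bool
  copyRelation ms i j = together ms (φ i) (φ j)

  copyPattern∈ : ∀ ms → AllPairs Disjoint ms → edgePattern (copyRelation ms) ∈ k211patterns
  copyPattern∈ ms ms# = pattern∈table (copyRelation ms) (λ i j → together-sym ms (φ i) (φ j))
                          (λ i j k → together-trans ms# (φ i) (φ j) (φ k))

  -- Below, the
  -- implicit arguments of lemmas about codes are given explicitly, since
  -- inferring them by unification would evaluate the table check.
  code : (ms : List (Graph n)) → AllPairs Disjoint ms → ℕ
  code ms ms# = toℕ (index (copyPattern∈ ms ms#)) + binary (uncurry (covered ms)) freeEdges * 13

  code< : ∀ ms ms# → code ms ms# < 13 * 2 ^ (edgeCount E ∸ 5)
  code< ms ms# = subst (code ms ms# <_) (*-comm (2 ^ (edgeCount E ∸ 5)) 13)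
    (digits-bound {13} {2 ^ (edgeCount E ∸ 5)} {toℕ (index p)} {binary (uncurry (covered ms)) freeEdges}
      (toℕ<n (index p)) (<-≤-trans (binary< _ freeEdges) (^-monoʳ-≤ 2 freeEdges-bound)))
    where p = copyPattern∈ ms ms#

  code-empty : code [] [] ≡ 0
  code-empty = cong (_* 13) (binary-zero freeEdges)

  module _ {ms : List (Graph n)} (ms-sub : All (IsESubgraph c E) ms) where

    covered-on-copy : ∀ {i j} → (i , j) ∈ k211edges →
                      uncurry (covered ms) (copyEdge (i , j)) ≡ copyRelation ms i j
    covered-on-copy {i} {j} ij∈ with orient-cases (φ i) (φ j)
    ... | inj₁ o rewrite o = covered≡together c E ms-sub (φ i) (φ j) (φ-cross ij∈)
    ... | inj₂ o rewrite o = begin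
      covered ms (φ j) (φ i)  ≡⟨ covered-sym c E ms-sub (φ j) (φ i) ⟩
      covered ms (φ i) (φ j)  ≡⟨ covered≡together c E ms-sub (φ i) (φ j) (φ-cross ij∈) ⟩
      together ms (φ i) (φ j) ∎
      where open ≡-Reasoning

  module _ {ms₁ ms₂ : List (Graph n)}
           (sub₁ : All (IsESubgraph c E) ms₁) (sub₂ : All (IsESubgraph c E) ms₂)
           (same-copy : ∀ {i j} → (i , j) ∈ k211edges → copyRelation ms₁ i j ≡ copyRelation ms₂ i j)
           (same-free : ∀ {z} → z ∈ freeEdges → uncurry (covered ms₁) z ≡ uncurry (covered ms₂) z)
           where

    agree-copy : ∀ {x y} → (x , y) ∈ copyEdges → covered ms₁ x y ≡ covered ms₂ x y
    agree-copy {x} {y} xy∈ with copyEdges⁻ xy∈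
    ... | i , j , ij∈ , xy≡ = begin
      covered ms₁ x y                          ≡⟨ cong (uncurry (covered ms₁)) xy≡ ⟩
      uncurry (covered ms₁) (copyEdge (i , j)) ≡⟨ covered-on-copy sub₁ ij∈ ⟩
      copyRelation ms₁ i j                     ≡⟨ same-copy ij∈ ⟩
      copyRelation ms₂ i j                     ≡⟨ covered-on-copy sub₂ ij∈ ⟨
      uncurry (covered ms₂) (copyEdge (i , j)) ≡⟨ cong (uncurry (covered ms₂)) xy≡ ⟨
      covered ms₂ x y                          ∎
      where open ≡-Reasoning

    agree-increasing : ∀ x y → toℕ x < toℕ y → covered ms₁ x y ≡ covered ms₂ x y
    agree-increasing x y x<y with E x y in exy | (x , y) ∈₂? copyEdges
    ... | false | _ = trans (covered-outside-E c E sub₁ x y exy) (sym (covered-outside-E c E sub₂ x y exy))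
    ... | true | yes xy∈ = agree-copy xy∈
    ... | true | no  xy∉ = same-free (∈-filter⁺ (λ z → T? (isEdge z ∧ not (inCopy z))) (∈-pairs x y)
      (∧-introᵀ (∧-introᵀ (<⇒<ᵇ x<y) (Equivalence.from T-≡ exy)) (fromWitnessFalse xy∉)))

    agree : ∀ x y → covered ms₁ x y ≡ covered ms₂ x y
    agree x y with <-cmp (toℕ x) (toℕ y)
    ... | tri< x<y _ _ = agree-increasing x y x<y
    ... | tri≈ _ x≡y _ rewrite toℕ-injective x≡y =
      trans (covered-irrefl c E sub₁ y) (sym (covered-irrefl c E sub₂ y))
    ... | tri> _ _ y<x = begin
      covered ms₁ x y ≡⟨ covered-sym c E sub₁ x y ⟩
      covered ms₁ y x ≡⟨ agree-increasing y x y<x ⟩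
      covered ms₂ y x ≡⟨ covered-sym c E sub₂ y x ⟩
      covered ms₂ x y ∎
      where open ≡-Reasoning

  code-injective : ∀ {ms₁ ms₂} → All (IsESubgraph c E) ms₁ → All (IsESubgraph c E) ms₂ →
    (ms₁# : AllPairs Disjoint ms₁) (ms₂# : AllPairs Disjoint ms₂) → code ms₁ ms₁# ≡ code ms₂ ms₂# →
    ∀ x y → covered ms₁ x y ≡ covered ms₂ x y
  code-injective {ms₁} {ms₂} sub₁ sub₂ ms₁# ms₂# eq = agree sub₁ sub₂ same-copy same-free
    where
    p₁ = copyPattern∈ ms₁ ms₁#
    p₂ = copyPattern∈ ms₂ ms₂#
    digits = digits-unique 13 {toℕ (index p₁)} {toℕ (index p₂)}
               {binary (uncurry (covered ms₁)) freeEdges} {binary (uncurry (covered ms₂)) freeEdges}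
               (toℕ<n (index p₁)) (toℕ<n (index p₂)) eq
    same-pattern : edgePattern (copyRelation ms₁) ≡ edgePattern (copyRelation ms₂)
    same-pattern = index-injective p₁ p₂ (proj₁ digits)
    same-copy : ∀ {i j} → (i , j) ∈ k211edges → copyRelation ms₁ i j ≡ copyRelation ms₂ i j
    same-copy = map-pointwise (uncurry (copyRelation ms₁)) (uncurry (copyRelation ms₂)) {k211edges} same-pattern
    same-free : ∀ {z} → z ∈ freeEdges → uncurry (covered ms₁) z ≡ uncurry (covered ms₂) z
    same-free = binary-injective (uncurry (covered ms₁)) (uncurry (covered ms₂)) freeEdges (proj₂ digits)

  garland-code : Garland c E → ℕ
  garland-code g = code (members g) (disjoint g)

  garland-code-injective : ∀ {g h} → garland-code g ≡ garland-code h → SameGarland g h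
  garland-code-injective {g} {h} eq = same-covered⇒same-garland c E g h
    (code-injective {members g} {members h} (areESub g) (areESub h) (disjoint g) (disjoint h) eq)

  code-zero-covers-nothing : ∀ {ms} → All (IsESubgraph c E) ms → (ms# : AllPairs Disjoint ms) →
    code ms ms# ≡ 0 → ∀ x y → covered ms x y ≡ false
  code-zero-covers-nothing {ms} sub ms# eq x y =
    code-injective {ms} {[]} sub [] ms# [] (trans eq (sym code-empty)) x y

  garland-code-nonzero : ∀ g → garland-code g ≢ 0
  garland-code-nonzero g eq =
    let (x , y , covers) = garland-covers-edge c E g
    in true≢false (trans (sym covers) (code-zero-covers-nothing {members g} (areESub g) (disjoint g) eq x y))

lemma7 : {n t : ℕ} (c : Fin n → Fin t) → Surjective _≡_ _≡_ c →
         (E : Fin n → Fin n → Bool) → IsEdgeSet c E →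
         (∃[ G ] (IsESubgraph c E G × IsoK211 G)) →
         (gs : List (Garland c E)) →
         AllPairs (λ g h → ¬ SameGarland g h) gs →
         length gs ≤ 13 * 2 ^ (edgeCount E ∸ 5) ∸ 1
lemma7 c _ E E-edges (G , G-sub , φ , φ-injective , _ , _ , φ-adj) gs gs-distinct =
  count-by-codes {_≈_ = SameGarland} garland-code {N} 0<N garland-code-nonzero
    (λ g → code< (members g) (disjoint g)) (λ {g} {h} → garland-code-injective {g} {h}) gs gs-distinct
  where
  copy-edge : ∀ {i j} → (i , j) ∈ k211edges → adj G (φ i) (φ j) ≡ true
  copy-edge {i} {j} ij∈ = trans (φ-adj i j) (All.lookup k211edges-adjacent ij∈)

  open Coding c E (IsEdgeSet.sym E-edges) φ φ-injective
    (λ ij∈ → IsESubgraph.subgraph G-sub _ _ (copy-edge ij∈))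
    (λ ij∈ → IsESubgraph.edgesInE G-sub _ _ (copy-edge ij∈))

  N : ℕ
  N = 13 * 2 ^ (edgeCount E ∸ 5)

  0<N : 0 < N
  0<N = subst (_< N) code-empty (code< [] [])
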